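{- Let $R$ be a commutative ring with identity. The $R$-algebras $(\mathcal W(R),+,\odot)$ and $(\mathcal W(R),+,\boxtimes)$ are isomorphic; an explicit isomorphism is $\psi(\mathbf a)=\mathbf a\star\mathbf e$, where $\mathbf e=((-1)^n)_{n\ge0}$.
   Context: $\mathcal W(R)$ is the set of linear recurrent sequences $(a_n)_{n\ge0}$ in $R$, i.e. sequences for which there exist $N\ge0$ and $h_1,\dots,h_N\in R$ with $a_n=\sum_{i=1}^{N}h_ia_{n-i}$ for all $n\ge N$. Operations: componentwise sum $(\mathbf a+\mathbf b)_n=a_n+b_n$; Hadamard product $(\mathbf a\odot\mathbf b)_n=a_nb_n$; Hurwitz product $(\mathbf a\star\mathbf b)_n=\sum_{i=0}^n\binom{n}{i}a_ib_{n-i}$; Newton product $(\mathbf a\boxtimes\mathbf b)_n=\sum_{i=0}^n\sum_{j=0}^i\binom{n}{i}\binom{i}{j}a_ib_{n-j}$. -}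

module Defs where

open import Level using (_⊔_)
open import Algebra.Bundles using (CommutativeRing)
open import Data.Nat using (ℕ; zero; suc; _∸_; _≤_)
open import Data.Nat.Combinatorics using (_C_)
open import Data.Product using (Σ)

module Seqs {c ℓ} (R : CommutativeRing c ℓ) where
  open CommutativeRing R

  Seq : Set c
  Seq = ℕ → Carrier

  _≈ₛ_ : Seq → Seq → Set ℓ
  a ≈ₛ b = ∀ n → a n ≈ b n

  natR : ℕ → Carrier
  natR zero = 0#
  natR (suc n) = 1# + natR n

  sumLt : (ℕ → Carrier) → ℕ → Carrier
  sumLt f zero = 0#
  sumLt f (suc n) = sumLt f n + f n

  -- linear recurrent sequence: ∃ N, h₁..h_N with a_n = Σ_{i=1}^N h_i a_{n-i} for n ≥ N
  -- (h is given as a function on ℕ; only h 1, ..., h N are used)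
  IsLRS : Seq → Set (c ⊔ ℓ)
  IsLRS a = Σ ℕ λ N → Σ (ℕ → Carrier) λ h →
            ∀ n → N ≤ n → a n ≈ sumLt (λ i → h (suc i) * a (n ∸ suc i)) N

  _+ₛ_ : Seq → Seq → Seq
  (a +ₛ b) n = a n + b n

  _·ₛ_ : Carrier → Seq → Seq
  (r ·ₛ a) n = r * a n

  _⊙_ : Seq → Seq → Seq
  (a ⊙ b) n = a n * b n

  _⋆_ : Seq → Seq → Seq
  (a ⋆ b) n = sumLt (λ i → natR (n C i) * (a i * b (n ∸ i))) (suc n)

  _⊠_ : Seq → Seq → Seq
  (a ⊠ b) n = sumLt (λ i → sumLt (λ j → natR (n C i) * natR (i C j) * (a i * b (n ∸ j))) (suc i)) (suc n)

  𝐞 : Seq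
  𝐞 zero = 1#
  𝐞 (suc n) = - 𝐞 n

  𝟙⊙ : Seq
  𝟙⊙ n = 1#

  𝟙⊠ : Seq
  𝟙⊠ zero = 1#
  𝟙⊠ (suc n) = 0#

  ψ : Seq → Seq
  ψ a = a ⋆ 𝐞

-- Write E for the shift (E a)ₙ = aₙ₊₁. Then ψ(a)ₙ = Σᵢ C(n,i) aᵢ (-1)ⁿ⁻ⁱ = (Δⁿ a)₀
-- with Δ = E - 1, and the Leibniz rule E(a ⋆ b) = Ea ⋆ b + a ⋆ Eb of the Hurwitz
-- product gives E(ψ a) = ψ(Ea) - ψ a. Hence ψ is inverted by the binomial transform
-- b ↦ b ⋆ (1,1,1,…), which satisfies the opposite rule. Since E(a ⊙ b) = Ea ⊙ Eb,
-- ψ(a ⊙ b) and ψ a ⊠ ψ b agree at 0 and obey the same recursion in n, which is the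
-- recursion of the Newton product. Finally, if E g = q g then E a ⋆ g = (E - q)(a ⋆ g),
-- so a ↦ a ⋆ g maps the span of the first N shifts of a into the span of the first N
-- shifts of a ⋆ g; this is why recurrences are preserved.

module Submission where

open import Defs
open import Algebra.Bundles using (CommutativeRing)
open import Data.Nat.Base as ℕ using (ℕ; zero; suc; _∸_; _<_; _≤′_; ≤′-refl; ≤′-step)
import Data.Nat.Properties as ℕₚ
open import Data.Nat.Combinatorics using (_C_; k>n⇒nCk≡0; nCk+nC[k+1]≡[n+1]C[k+1])
open import Data.Product using (Σ; _×_; _,_)
open import Level using (_⊔_)
open import Relation.Binary.PropositionalEquality as ≡ using (_≡_)
open import Relation.Nullary using (yes; no; contradiction)

module BinomialTransform {c ℓ} (R : CommutativeRing c ℓ) where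
  open CommutativeRing R
  open Seqs R
  open import Algebra.Properties.Ring ring using (-1*x≈-x; -‿distribˡ-*; -‿involutive; x≈z//y; //-rightDividesʳ)
  open import Algebra.Properties.CommutativeSemigroup +-commutativeSemigroup
    using () renaming (interchange to +-interchange)
  open import Algebra.Properties.CommutativeSemigroup *-commutativeSemigroup
    using () renaming (x∙yz≈y∙xz to x*yz≈y*xz)
  open import Algebra.Solver.Ring.NaturalCoefficients.Default commutativeSemiring
  open import Relation.Binary.Reasoning.Setoid setoid

  E : Seq → Seq
  E a n = a (suc n)

  E^ : ℕ → Seq → Seq
  E^ k a n = a (k ℕ.+ n)

  sumLt-cong : ∀ {f f′ : ℕ → Carrier} k → (∀ i → f i ≈ f′ i) → sumLt f k ≈ sumLt f′ k
  sumLt-cong zero    f≈f′ = refl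
  sumLt-cong (suc k) f≈f′ = +-cong (sumLt-cong k f≈f′) (f≈f′ k)

  sumLt-cong< : ∀ {f f′ : ℕ → Carrier} k → (∀ i → i < k → f i ≈ f′ i) → sumLt f k ≈ sumLt f′ k
  sumLt-cong< zero    f≈f′ = refl
  sumLt-cong< (suc k) f≈f′ =
    +-cong (sumLt-cong< k (λ i i<k → f≈f′ i (ℕₚ.m<n⇒m<1+n i<k))) (f≈f′ k (ℕₚ.n<1+n k))

  sumLt-+ : ∀ {f f′ : ℕ → Carrier} k → sumLt (λ i → f i + f′ i) k ≈ sumLt f k + sumLt f′ k
  sumLt-+ zero    = sym (+-identityˡ 0#)
  sumLt-+ (suc k) = trans (+-congʳ (sumLt-+ k)) (+-interchange _ _ _ _)

  sumLt-*ˡ : ∀ {f : ℕ → Carrier} r k → sumLt (λ i → r * f i) k ≈ r * sumLt f k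
  sumLt-*ˡ r zero    = sym (zeroʳ r)
  sumLt-*ˡ r (suc k) = trans (+-congʳ (sumLt-*ˡ r k)) (sym (distribˡ r _ _))

  sumLt-zero : ∀ {f : ℕ → Carrier} k → (∀ i → f i ≈ 0#) → sumLt f k ≈ 0#
  sumLt-zero zero    f≈0 = refl
  sumLt-zero (suc k) f≈0 = trans (+-cong (sumLt-zero k f≈0) (f≈0 k)) (+-identityˡ 0#)

  sumLt-head : ∀ (f : ℕ → Carrier) k → sumLt f (suc k) ≈ f 0 + sumLt (λ i → f (suc i)) k
  sumLt-head f zero    = +-comm 0# (f 0)
  sumLt-head f (suc k) = trans (+-congʳ (sumLt-head f k)) (+-assoc (f 0) _ _)

  sumLt-reverse : ∀ (f : ℕ → Carrier) k → sumLt f k ≈ sumLt (λ i → f (k ∸ suc i)) k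
  sumLt-reverse f zero    = refl
  sumLt-reverse f (suc k) = begin
    sumLt f k + f k                        ≈⟨ +-congʳ (sumLt-reverse f k) ⟩
    sumLt (λ i → f (k ∸ suc i)) k + f k    ≈⟨ +-comm _ _ ⟩
    f k + sumLt (λ i → f (k ∸ suc i)) k    ≈⟨ sumLt-head (λ i → f (suc k ∸ suc i)) k ⟨
    sumLt (λ i → f (suc k ∸ suc i)) (suc k) ∎

  natR-+ : ∀ m n → natR (m ℕ.+ n) ≈ natR m + natR n
  natR-+ zero    n = sym (+-identityˡ (natR n))
  natR-+ (suc m) n = trans (+-congˡ (natR-+ m n)) (sym (+-assoc 1# (natR m) (natR n)))

  natR-1 : natR 1 ≈ 1#
  natR-1 = +-identityʳ 1#

  natR-1* : ∀ x → natR 1 * x ≈ x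
  natR-1* x = trans (*-congʳ natR-1) (*-identityˡ x)

  natR-pascal : ∀ n k → natR (suc n C suc k) ≈ natR (n C k) + natR (n C suc k)
  natR-pascal n k = trans (reflexive (≡.cong natR (≡.sym (nCk+nC[k+1]≡[n+1]C[k+1] n k))))
                          (natR-+ (n C k) (n C suc k))

  sumLt-pascal : ∀ (f : ℕ → Carrier) n →
    sumLt (λ j → natR (suc n C j) * f j) (suc (suc n))
      ≈ sumLt (λ j → natR (n C j) * f j) (suc n) + sumLt (λ j → natR (n C j) * f (suc j)) (suc n)
  sumLt-pascal f n = begin
    sumLt (λ j → natR (suc n C j) * f j) (suc (suc n))
      ≈⟨ sumLt-head _ (suc n) ⟩
    natR 1 * f 0 + sumLt (λ j → natR (suc n C suc j) * f (suc j)) (suc n)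
      ≈⟨ +-congˡ (sumLt-cong (suc n) (λ j → trans (*-congʳ (natR-pascal n j)) (distribʳ _ _ _))) ⟩
    natR 1 * f 0 + sumLt (λ j → natR (n C j) * f (suc j) + natR (n C suc j) * f (suc j)) (suc n)
      ≈⟨ +-congˡ (sumLt-+ (suc n)) ⟩
    natR 1 * f 0 + (Y + (X + natR (n C suc n) * f (suc n)))
      ≈⟨ +-congˡ (+-congˡ (+-congˡ (trans (*-congʳ nC[n+1]≈0) (zeroˡ _)))) ⟩
    natR 1 * f 0 + (Y + (X + 0#))
      ≈⟨ solve 3 (λ a x y → a :+ (y :+ (x :+ con 0)) := (a :+ x) :+ y) refl (natR 1 * f 0) X Y ⟩
    (natR 1 * f 0 + X) + Y
      ≈⟨ +-congʳ (sumLt-head (λ j → natR (n C j) * f j) n) ⟨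
    sumLt (λ j → natR (n C j) * f j) (suc n) + Y ∎
    where
    X = sumLt (λ j → natR (n C suc j) * f (suc j)) n
    Y = sumLt (λ j → natR (n C j) * f (suc j)) (suc n)
    nC[n+1]≈0 : natR (n C suc n) ≈ 0#
    nC[n+1]≈0 = reflexive (≡.cong natR (k>n⇒nCk≡0 (ℕₚ.n<1+n n)))

  binomialConv : (ℕ → ℕ → Carrier) → Seq
  binomialConv F n = sumLt (λ i → natR (n C i) * F i (n ∸ i)) (suc n)

  binomialConv-cong : ∀ {F F′} n → (∀ i m → F i m ≈ F′ i m) → binomialConv F n ≈ binomialConv F′ n
  binomialConv-cong n F≈F′ = sumLt-cong (suc n) (λ i → *-congˡ (F≈F′ i (n ∸ i)))

  binomialConv-+ : ∀ F F′ n →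
    binomialConv (λ i m → F i m + F′ i m) n ≈ binomialConv F n + binomialConv F′ n
  binomialConv-+ F F′ n = trans (sumLt-cong (suc n) (λ i → distribˡ _ _ _)) (sumLt-+ (suc n))

  binomialConv-*ˡ : ∀ r F n → binomialConv (λ i m → r * F i m) n ≈ r * binomialConv F n
  binomialConv-*ˡ r F n = trans (sumLt-cong (suc n) (λ i → x*yz≈y*xz _ r _)) (sumLt-*ˡ r (suc n))

  binomialConv-zero : ∀ F → binomialConv F 0 ≈ F 0 0
  binomialConv-zero F = trans (+-identityˡ _) (natR-1* _)

  binomialConv-suc : ∀ F n →
    binomialConv F (suc n) ≈ binomialConv (λ i m → F i (suc m)) n + binomialConv (λ i m → F (suc i) m) n
  binomialConv-suc F n = trans (sumLt-pascal (λ i → F i (suc n ∸ i)) n)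
    (+-congʳ (sumLt-cong< (suc n) λ i i<1+n →
      *-congˡ (reflexive (≡.cong (F i) (ℕₚ.+-∸-assoc 1 (ℕₚ.≤-pred i<1+n))))))

  ⋆-congˡ : ∀ {a a′} b → a ≈ₛ a′ → (a ⋆ b) ≈ₛ (a′ ⋆ b)
  ⋆-congˡ b a≈a′ n = binomialConv-cong n (λ i m → *-congʳ {b m} (a≈a′ i))

  ⋆-congʳ : ∀ a {b b′} → b ≈ₛ b′ → (a ⋆ b) ≈ₛ (a ⋆ b′)
  ⋆-congʳ a b≈b′ n = binomialConv-cong n (λ i m → *-congˡ {a i} (b≈b′ m))

  ⋆-+ˡ : ∀ a a′ b → ((a +ₛ a′) ⋆ b) ≈ₛ ((a ⋆ b) +ₛ (a′ ⋆ b))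
  ⋆-+ˡ a a′ b n = trans (binomialConv-cong n (λ i m → distribʳ (b m) (a i) (a′ i)))
                        (binomialConv-+ (λ i m → a i * b m) (λ i m → a′ i * b m) n)

  ⋆-·ˡ : ∀ r a b → ((r ·ₛ a) ⋆ b) ≈ₛ (r ·ₛ (a ⋆ b))
  ⋆-·ˡ r a b n = trans (binomialConv-cong n (λ i m → *-assoc r (a i) (b m)))
                       (binomialConv-*ˡ r (λ i m → a i * b m) n)

  ⋆-·ʳ : ∀ r a b → (a ⋆ (r ·ₛ b)) ≈ₛ (r ·ₛ (a ⋆ b))
  ⋆-·ʳ r a b n = trans (binomialConv-cong n (λ i m → x*yz≈y*xz (a i) r (b m)))
                       (binomialConv-*ˡ r (λ i m → a i * b m) n)

  ⋆-zero : ∀ a b → (a ⋆ b) 0 ≈ a 0 * b 0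
  ⋆-zero a b = binomialConv-zero (λ i m → a i * b m)

  ⋆-leibniz : ∀ a b → E (a ⋆ b) ≈ₛ ((a ⋆ E b) +ₛ (E a ⋆ b))
  ⋆-leibniz a b = binomialConv-suc (λ i m → a i * b m)

  ⋆-sumLtˡ : ∀ M (z : ℕ → Seq) (cf : ℕ → Carrier) b →
    ((λ k → sumLt (λ j → cf j * z j k) M) ⋆ b) ≈ₛ (λ n → sumLt (λ j → cf j * (z j ⋆ b) n) M)
  ⋆-sumLtˡ zero    z cf b n = sumLt-zero (suc n) (λ i → trans (*-congˡ (zeroˡ _)) (zeroʳ _))
  ⋆-sumLtˡ (suc M) z cf b n = trans (⋆-+ˡ _ (cf M ·ₛ z M) b n)
                                    (+-cong (⋆-sumLtˡ M z cf b n) (⋆-·ˡ (cf M) (z M) b n))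

  Geometric : Carrier → Seq → Set ℓ
  Geometric q g = E g ≈ₛ (q ·ₛ g)

  𝐞-geometric : Geometric (- 1#) 𝐞
  𝐞-geometric n = sym (-1*x≈-x (𝐞 n))

  𝟙⊙-geometric : Geometric 1# 𝟙⊙
  𝟙⊙-geometric n = sym (*-identityˡ 1#)

  ⋆-geometric-suc : ∀ {q g} → Geometric q g → ∀ a → E (a ⋆ g) ≈ₛ ((E a ⋆ g) +ₛ (q ·ₛ (a ⋆ g)))
  ⋆-geometric-suc {q} {g} g-geo a n = begin
    (a ⋆ g) (suc n)               ≈⟨ ⋆-leibniz a g n ⟩
    (a ⋆ E g) n + (E a ⋆ g) n     ≈⟨ +-congʳ (trans (⋆-congʳ a g-geo n) (⋆-·ʳ q a g n)) ⟩
    q * (a ⋆ g) n + (E a ⋆ g) n   ≈⟨ +-comm _ _ ⟩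
    (E a ⋆ g) n + q * (a ⋆ g) n   ∎

  ⋆-geometric-E : ∀ {q g} → Geometric q g → ∀ a → (E a ⋆ g) ≈ₛ (E (a ⋆ g) +ₛ ((- q) ·ₛ (a ⋆ g)))
  ⋆-geometric-E {q} {g} g-geo a n = begin
    (E a ⋆ g) n                        ≈⟨ x≈z//y _ _ _ (sym (⋆-geometric-suc g-geo a n)) ⟩
    (a ⋆ g) (suc n) - q * (a ⋆ g) n    ≈⟨ +-congˡ (-‿distribˡ-* q _) ⟩
    (a ⋆ g) (suc n) + - q * (a ⋆ g) n  ∎

  ⋆-geometric-inverse : ∀ {p q g h} → Geometric p g → Geometric q h → p + q ≈ 0# →
                        g 0 ≈ 1# → h 0 ≈ 1# → ∀ a → ((a ⋆ g) ⋆ h) ≈ₛ a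
  ⋆-geometric-inverse {p} {q} {g} {h} g-geo h-geo p+q≈0 g₀≈1 h₀≈1 a n = inverse n a
    where
    inverse : ∀ n a → ((a ⋆ g) ⋆ h) n ≈ a n
    inverse zero a = begin
      ((a ⋆ g) ⋆ h) 0   ≈⟨ ⋆-zero (a ⋆ g) h ⟩
      (a ⋆ g) 0 * h 0   ≈⟨ *-cong (⋆-zero a g) h₀≈1 ⟩
      a 0 * g 0 * 1#    ≈⟨ *-identityʳ _ ⟩
      a 0 * g 0         ≈⟨ *-congˡ g₀≈1 ⟩
      a 0 * 1#          ≈⟨ *-identityʳ _ ⟩
      a 0               ∎
    inverse (suc n) a = begin
      ((a ⋆ g) ⋆ h) (suc n)
        ≈⟨ ⋆-geometric-suc h-geo (a ⋆ g) n ⟩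
      (E (a ⋆ g) ⋆ h) n + q * ((a ⋆ g) ⋆ h) n
        ≈⟨ +-congʳ (⋆-congˡ h (⋆-geometric-suc g-geo a) n) ⟩
      (((E a ⋆ g) +ₛ (p ·ₛ (a ⋆ g))) ⋆ h) n + q * ((a ⋆ g) ⋆ h) n
        ≈⟨ +-congʳ (trans (⋆-+ˡ (E a ⋆ g) _ h n) (+-congˡ (⋆-·ˡ p (a ⋆ g) h n))) ⟩
      (((E a ⋆ g) ⋆ h) n + p * ((a ⋆ g) ⋆ h) n) + q * ((a ⋆ g) ⋆ h) n
        ≈⟨ +-cong (+-cong (inverse n (E a)) (*-congˡ (inverse n a))) (*-congˡ (inverse n a)) ⟩
      (a (suc n) + p * a n) + q * a n
        ≈⟨ +-assoc _ _ _ ⟩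
      a (suc n) + (p * a n + q * a n)
        ≈⟨ +-congˡ (trans (sym (distribʳ (a n) p q)) (trans (*-congʳ p+q≈0) (zeroˡ (a n)))) ⟩
      a (suc n) + 0#
        ≈⟨ +-identityʳ _ ⟩
      a (suc n) ∎

  ψ[b⋆𝟙⊙]≈b : ∀ b → ψ (b ⋆ 𝟙⊙) ≈ₛ b
  ψ[b⋆𝟙⊙]≈b = ⋆-geometric-inverse 𝟙⊙-geometric 𝐞-geometric (-‿inverseʳ 1#) refl refl

  ψ[a]⋆𝟙⊙≈a : ∀ a → (ψ a ⋆ 𝟙⊙) ≈ₛ a
  ψ[a]⋆𝟙⊙≈a = ⋆-geometric-inverse 𝐞-geometric 𝟙⊙-geometric (-‿inverseˡ 1#) refl refl

  ψ-injective : ∀ {a b} → ψ a ≈ₛ ψ b → a ≈ₛ b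
  ψ-injective {a} {b} ψa≈ψb n = begin
    a n              ≈⟨ ψ[a]⋆𝟙⊙≈a a n ⟨
    (ψ a ⋆ 𝟙⊙) n     ≈⟨ ⋆-congˡ 𝟙⊙ ψa≈ψb n ⟩
    (ψ b ⋆ 𝟙⊙) n     ≈⟨ ψ[a]⋆𝟙⊙≈a b n ⟩
    b n              ∎

  ψ-zero : ∀ a → ψ a 0 ≈ a 0
  ψ-zero a = trans (⋆-zero a 𝐞) (*-identityʳ (a 0))

  ψ-E : ∀ a → ψ (E a) ≈ₛ (E (ψ a) +ₛ ψ a)
  ψ-E a n = trans (⋆-geometric-E 𝐞-geometric a n)
                  (+-congˡ (trans (*-congʳ (-‿involutive 1#)) (*-identityˡ _)))

  ψ-𝟙⊙ : ψ 𝟙⊙ ≈ₛ 𝟙⊠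
  ψ-𝟙⊙ zero    = ψ-zero 𝟙⊙
  ψ-𝟙⊙ (suc n) = begin
    ψ 𝟙⊙ (suc n)                     ≈⟨ ⋆-geometric-suc 𝐞-geometric 𝟙⊙ n ⟩
    ψ 𝟙⊙ n + - 1# * ψ 𝟙⊙ n           ≈⟨ +-congˡ (-1*x≈-x _) ⟩
    ψ 𝟙⊙ n - ψ 𝟙⊙ n                  ≈⟨ -‿inverseʳ _ ⟩
    0#                               ∎

  -- binomialShift v i m = ((1 + E)ⁱ v)ₘ, summed in reverse so that
  -- (u ⊠ v)ₙ = Σᵢ C(n,i) uᵢ · binomialShift v i (n ∸ i).
  binomialShift : Seq → ℕ → ℕ → Carrier
  binomialShift v i m = sumLt (λ j → natR (i C j) * v ((i ℕ.+ m) ∸ j)) (suc i)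

  binomialShift-+ : ∀ v v′ i m → binomialShift (v +ₛ v′) i m ≈ binomialShift v i m + binomialShift v′ i m
  binomialShift-+ v v′ i m = trans (sumLt-cong (suc i) (λ j → distribˡ _ _ _)) (sumLt-+ (suc i))

  binomialShift-zero : ∀ v m → binomialShift v 0 m ≈ v m
  binomialShift-zero v m = trans (+-identityˡ _) (natR-1* (v m))

  binomialShift-suc : ∀ v i m → binomialShift v (suc i) m ≈ binomialShift v i (suc m) + binomialShift v i m
  binomialShift-suc v i m = trans (sumLt-pascal (λ j → v ((suc i ℕ.+ m) ∸ j)) i)
    (+-congʳ (sumLt-cong (suc i) (λ j →
      *-congˡ (reflexive (≡.cong (λ k → v (k ∸ j)) (≡.sym (ℕₚ.+-suc i m)))))))

  binomialShift-E : ∀ v i m → binomialShift (E v) i m ≈ binomialShift v i (suc m)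
  binomialShift-E v i m = sumLt-cong< (suc i) λ j j<1+i → *-congˡ (reflexive (≡.cong v
    (≡.trans (≡.sym (ℕₚ.+-∸-assoc 1 (ℕₚ.≤-trans (ℕₚ.≤-pred j<1+i) (ℕₚ.m≤m+n i m))))
             (≡.cong (_∸ j) (≡.sym (ℕₚ.+-suc i m))))))

  newtonTerms : Seq → Seq → ℕ → ℕ → Carrier
  newtonTerms u v i m = u i * binomialShift v i m

  ⊠≈binomialConv : ∀ u v n → (u ⊠ v) n ≈ binomialConv (newtonTerms u v) n
  ⊠≈binomialConv u v n = sumLt-cong< (suc n) λ i i<1+n → begin
    sumLt (λ j → natR (n C i) * natR (i C j) * (u i * v (n ∸ j))) (suc i)
      ≈⟨ sumLt-cong (suc i) (λ j → rearrange (natR (n C i)) (natR (i C j)) (u i) (v (n ∸ j))) ⟩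
    sumLt (λ j → (natR (n C i) * u i) * (natR (i C j) * v (n ∸ j))) (suc i)
      ≈⟨ sumLt-*ˡ (natR (n C i) * u i) (suc i) ⟩
    (natR (n C i) * u i) * sumLt (λ j → natR (i C j) * v (n ∸ j)) (suc i)
      ≈⟨ *-assoc _ _ _ ⟩
    natR (n C i) * (u i * sumLt (λ j → natR (i C j) * v (n ∸ j)) (suc i))
      ≈⟨ *-congˡ (*-congˡ (sumLt-cong (suc i) (λ j → *-congˡ (reflexive
           (≡.cong (λ k → v (k ∸ j)) (≡.sym (ℕₚ.m+[n∸m]≡n (ℕₚ.≤-pred i<1+n)))))))) ⟩
    natR (n C i) * (u i * binomialShift v i (n ∸ i)) ∎
    where
    rearrange : ∀ a b c d → a * b * (c * d) ≈ (a * c) * (b * d)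
    rearrange = solve 4 (λ a b c d → a :* b :* (c :* d) := (a :* c) :* (b :* d)) refl

  ⊠-cong : ∀ {u u′ v v′} → u ≈ₛ u′ → v ≈ₛ v′ → (u ⊠ v) ≈ₛ (u′ ⊠ v′)
  ⊠-cong u≈u′ v≈v′ n = sumLt-cong (suc n) λ i → sumLt-cong (suc i) λ j →
    *-congˡ (*-cong (u≈u′ i) (v≈v′ (n ∸ j)))

  ⊠-zero : ∀ u v → (u ⊠ v) 0 ≈ u 0 * v 0
  ⊠-zero u v = trans (⊠≈binomialConv u v 0)
    (trans (binomialConv-zero (newtonTerms u v)) (*-congˡ (binomialShift-zero v 0)))

  ⊠-+ˡ : ∀ u u′ v → ((u +ₛ u′) ⊠ v) ≈ₛ ((u ⊠ v) +ₛ (u′ ⊠ v))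
  ⊠-+ˡ u u′ v n = begin
    ((u +ₛ u′) ⊠ v) n
      ≈⟨ ⊠≈binomialConv (u +ₛ u′) v n ⟩
    binomialConv (λ i m → (u i + u′ i) * binomialShift v i m) n
      ≈⟨ binomialConv-cong n (λ i m → distribʳ (binomialShift v i m) (u i) (u′ i)) ⟩
    binomialConv (λ i m → u i * binomialShift v i m + u′ i * binomialShift v i m) n
      ≈⟨ binomialConv-+ (newtonTerms u v) (newtonTerms u′ v) n ⟩
    binomialConv (newtonTerms u v) n + binomialConv (newtonTerms u′ v) n
      ≈⟨ +-cong (⊠≈binomialConv u v n) (⊠≈binomialConv u′ v n) ⟨
    (u ⊠ v) n + (u′ ⊠ v) n ∎

  ⊠-+ʳ : ∀ u v v′ → (u ⊠ (v +ₛ v′)) ≈ₛ ((u ⊠ v) +ₛ (u ⊠ v′))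
  ⊠-+ʳ u v v′ n = begin
    (u ⊠ (v +ₛ v′)) n
      ≈⟨ ⊠≈binomialConv u (v +ₛ v′) n ⟩
    binomialConv (λ i m → u i * binomialShift (v +ₛ v′) i m) n
      ≈⟨ binomialConv-cong n (λ i m → trans (*-congˡ (binomialShift-+ v v′ i m)) (distribˡ (u i) _ _)) ⟩
    binomialConv (λ i m → u i * binomialShift v i m + u i * binomialShift v′ i m) n
      ≈⟨ binomialConv-+ (newtonTerms u v) (newtonTerms u v′) n ⟩
    binomialConv (newtonTerms u v) n + binomialConv (newtonTerms u v′) n
      ≈⟨ +-cong (⊠≈binomialConv u v n) (⊠≈binomialConv u v′ n) ⟨
    (u ⊠ v) n + (u ⊠ v′) n ∎

  ⊠-suc : ∀ u v → E (u ⊠ v) ≈ₛ ((u ⊠ E v) +ₛ ((E u ⊠ E v) +ₛ (E u ⊠ v)))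
  ⊠-suc u v n = begin
    (u ⊠ v) (suc n)
      ≈⟨ ⊠≈binomialConv u v (suc n) ⟩
    binomialConv (newtonTerms u v) (suc n)
      ≈⟨ binomialConv-suc (newtonTerms u v) n ⟩
    binomialConv (λ i m → u i * binomialShift v i (suc m)) n
      + binomialConv (λ i m → u (suc i) * binomialShift v (suc i) m) n
      ≈⟨ +-congʳ (binomialConv-cong n (λ i m → *-congˡ {u i} (binomialShift-E v i m))) ⟨
    binomialConv (newtonTerms u (E v)) n
      + binomialConv (λ i m → u (suc i) * binomialShift v (suc i) m) n
      ≈⟨ +-congˡ (binomialConv-cong n (λ i m →
           trans (*-congˡ (binomialShift-suc v i m)) (distribˡ (u (suc i)) _ _))) ⟩
    binomialConv (newtonTerms u (E v)) n
      + binomialConv (λ i m → u (suc i) * binomialShift v i (suc m) + u (suc i) * binomialShift v i m) n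
      ≈⟨ +-congˡ (binomialConv-+ (λ i m → u (suc i) * binomialShift v i (suc m)) (newtonTerms (E u) v) n) ⟩
    binomialConv (newtonTerms u (E v)) n
      + (binomialConv (λ i m → u (suc i) * binomialShift v i (suc m)) n
         + binomialConv (newtonTerms (E u) v) n)
      ≈⟨ +-congˡ (+-congʳ (binomialConv-cong n (λ i m → *-congˡ {u (suc i)} (binomialShift-E v i m)))) ⟨
    binomialConv (newtonTerms u (E v)) n
      + (binomialConv (newtonTerms (E u) (E v)) n
         + binomialConv (newtonTerms (E u) v) n)
      ≈⟨ +-cong (⊠≈binomialConv u (E v) n) (+-cong (⊠≈binomialConv (E u) (E v) n) (⊠≈binomialConv (E u) v n)) ⟨
    (u ⊠ E v) n + ((E u ⊠ E v) n + (E u ⊠ v) n) ∎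

  ψ-⊙ : ∀ a b → ψ (a ⊙ b) ≈ₛ (ψ a ⊠ ψ b)
  ψ-⊙ a b zero = trans (ψ-zero (a ⊙ b))
    (sym (trans (⊠-zero (ψ a) (ψ b)) (*-cong (ψ-zero a) (ψ-zero b))))
  ψ-⊙ a b (suc n) = begin
    ψ (a ⊙ b) (suc n)
      ≈⟨ ⋆-geometric-suc 𝐞-geometric (a ⊙ b) n ⟩
    ψ (E a ⊙ E b) n + - 1# * ψ (a ⊙ b) n
      ≈⟨ +-cong (ψ-⊙ (E a) (E b) n) (trans (-1*x≈-x _) (-‿cong (ψ-⊙ a b n))) ⟩
    (ψ (E a) ⊠ ψ (E b)) n - W
      ≈⟨ +-congʳ (⊠-cong (ψ-E a) (ψ-E b) n) ⟩
    ((E A +ₛ A) ⊠ (E B +ₛ B)) n - W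
      ≈⟨ +-congʳ (trans (⊠-+ˡ (E A) A (E B +ₛ B) n) (+-cong (⊠-+ʳ (E A) (E B) B n) (⊠-+ʳ A (E B) B n))) ⟩
    ((X + Y) + (Z + W)) - W
      ≈⟨ +-congʳ (solve 4 (λ x y z w → (x :+ y) :+ (z :+ w) := (z :+ (x :+ y)) :+ w) refl X Y Z W) ⟩
    ((Z + (X + Y)) + W) - W
      ≈⟨ //-rightDividesʳ W _ ⟩
    Z + (X + Y)
      ≈⟨ ⊠-suc A B n ⟨
    (A ⊠ B) (suc n) ∎
    where
    A = ψ a
    B = ψ b
    X = (E A ⊠ E B) n
    Y = (E A ⊠ B) n
    Z = (A ⊠ E B) n
    W = (A ⊠ B) n

  record InShiftSpan (k : ℕ) (x y : Seq) : Set (c ⊔ ℓ) where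
    constructor shiftSpan
    field
      coeff  : ℕ → Carrier
      expand : ∀ n → y n ≈ sumLt (λ j → coeff j * x (j ℕ.+ n)) k

  zero∈span : ∀ k {x y} → (∀ n → y n ≈ 0#) → InShiftSpan k x y
  zero∈span k y≈0 = shiftSpan (λ _ → 0#) (λ n → trans (y≈0 n) (sym (sumLt-zero k (λ j → zeroˡ _))))

  span-resp : ∀ {k x y z} → y ≈ₛ z → InShiftSpan k x y → InShiftSpan k x z
  span-resp y≈z (shiftSpan cf y≈) = shiftSpan cf (λ n → trans (sym (y≈z n)) (y≈ n))

  span-+ : ∀ {k x y z} → InShiftSpan k x y → InShiftSpan k x z → InShiftSpan k x (y +ₛ z)
  span-+ {k} {x} (shiftSpan c₁ y≈) (shiftSpan c₂ z≈) = shiftSpan (λ j → c₁ j + c₂ j) λ n →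
    trans (+-cong (y≈ n) (z≈ n))
          (trans (sym (sumLt-+ k)) (sumLt-cong k (λ j → sym (distribʳ (x (j ℕ.+ n)) (c₁ j) (c₂ j)))))

  span-· : ∀ {k x y} r → InShiftSpan k x y → InShiftSpan k x (r ·ₛ y)
  span-· {k} {x} r (shiftSpan cf y≈) = shiftSpan (λ j → r * cf j) λ n →
    trans (*-congˡ (y≈ n)) (trans (sym (sumLt-*ˡ r k)) (sumLt-cong k (λ j → sym (*-assoc r (cf j) _))))

  span-E : ∀ {k x y} → InShiftSpan k x y → InShiftSpan (suc k) x (E y)
  span-E {k} {x} {y} (shiftSpan cf y≈) = shiftSpan cf′ λ n → begin
    y (suc n)                                      ≈⟨ y≈ (suc n) ⟩
    sumLt (λ j → cf j * x (j ℕ.+ suc n)) k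
      ≈⟨ sumLt-cong k (λ j → *-congˡ (reflexive (≡.cong x (ℕₚ.+-suc j n)))) ⟩
    sumLt (λ j → cf j * x (suc j ℕ.+ n)) k          ≈⟨ +-identityˡ _ ⟨
    0# + sumLt (λ j → cf j * x (suc j ℕ.+ n)) k     ≈⟨ +-congʳ (zeroˡ (x n)) ⟨
    0# * x n + sumLt (λ j → cf j * x (suc j ℕ.+ n)) k ≈⟨ sumLt-head (λ j → cf′ j * x (j ℕ.+ n)) k ⟨
    sumLt (λ j → cf′ j * x (j ℕ.+ n)) (suc k)       ∎
    where
    cf′ : ℕ → Carrier
    cf′ zero    = 0#
    cf′ (suc j) = cf j

  span-suc : ∀ {k x y} → InShiftSpan k x y → InShiftSpan (suc k) x y
  span-suc {k} {x} {y} (shiftSpan cf y≈) = shiftSpan cf′ λ n → begin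
    y n                                          ≈⟨ y≈ n ⟩
    sumLt (λ j → cf j * x (j ℕ.+ n)) k
      ≈⟨ sumLt-cong< k (λ j j<k → *-congʳ (reflexive (≡.sym (cf′-below j<k)))) ⟩
    sumLt (λ j → cf′ j * x (j ℕ.+ n)) k          ≈⟨ +-identityʳ _ ⟨
    sumLt (λ j → cf′ j * x (j ℕ.+ n)) k + 0#
      ≈⟨ +-congˡ (trans (*-congʳ (reflexive cf′-at-k)) (zeroˡ _)) ⟨
    sumLt (λ j → cf′ j * x (j ℕ.+ n)) (suc k)    ∎
    where
    cf′ : ℕ → Carrier
    cf′ j with j ℕₚ.<? k
    ... | yes _ = cf j
    ... | no  _ = 0#
    cf′-below : ∀ {j} → j < k → cf′ j ≡ cf j
    cf′-below {j} j<k with j ℕₚ.<? k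
    ... | yes _   = ≡.refl
    ... | no  j≮k = contradiction j<k j≮k
    cf′-at-k : cf′ k ≡ 0#
    cf′-at-k with k ℕₚ.<? k
    ... | yes k<k = contradiction k<k (ℕₚ.n≮n k)
    ... | no  _   = ≡.refl

  span-≤′ : ∀ {j k x y} → j ≤′ k → InShiftSpan j x y → InShiftSpan k x y
  span-≤′ ≤′-refl       y∈span = y∈span
  span-≤′ (≤′-step j≤k) y∈span = span-suc (span-≤′ j≤k y∈span)

  E^∈span : ∀ k x → InShiftSpan (suc k) x (E^ k x)
  E^∈span zero    x = shiftSpan (λ _ → 1#) (λ n → sym (trans (+-identityˡ _) (*-identityˡ _)))
  E^∈span (suc k) x = span-resp (λ n → reflexive (≡.cong x (ℕₚ.+-suc k n))) (span-E (E^∈span k x))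

  span-sumLt : ∀ {N x} M (z : ℕ → Seq) (cf : ℕ → Carrier) → (∀ j → j < M → InShiftSpan N x (z j)) →
               InShiftSpan N x (λ n → sumLt (λ j → cf j * z j n) M)
  span-sumLt {N} zero    z cf z∈span = zero∈span N (λ _ → refl)
  span-sumLt     (suc M) z cf z∈span =
    span-+ (span-sumLt M z cf (λ j j<M → z∈span j (ℕₚ.m<n⇒m<1+n j<M))) (span-· (cf M) (z∈span M (ℕₚ.n<1+n M)))

  HasRecurrence : ℕ → Seq → Set (c ⊔ ℓ)
  HasRecurrence N a = InShiftSpan N a (E^ N a)

  -- IsLRS writes aₙ = Σᵢ hᵢ₊₁ aₙ₋ᵢ₋₁ (i < N); the shift span uses the reversed
  -- coefficients cⱼ = h (N ∸ j), so that a (N + n) = Σⱼ cⱼ a (j + n).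
  isLRS⇒hasRecurrence : ∀ {a} → IsLRS a → Σ ℕ λ N → HasRecurrence N a
  isLRS⇒hasRecurrence {a} (N , h , a≈) = N , shiftSpan (λ j → h (suc (N ∸ suc j))) λ n → begin
    a (N ℕ.+ n)
      ≈⟨ a≈ (N ℕ.+ n) (ℕₚ.m≤m+n N n) ⟩
    sumLt (λ i → h (suc i) * a ((N ℕ.+ n) ∸ suc i)) N
      ≈⟨ sumLt-reverse _ N ⟩
    sumLt (λ j → h (suc (N ∸ suc j)) * a ((N ℕ.+ n) ∸ suc (N ∸ suc j))) N
      ≈⟨ sumLt-cong< N (λ j j<N → *-congˡ (reflexive (≡.cong a (reversed-index n j<N)))) ⟩
    sumLt (λ j → h (suc (N ∸ suc j)) * a (j ℕ.+ n)) N ∎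
    where
    reversed-index : ∀ n {j} → j < N → (N ℕ.+ n) ∸ suc (N ∸ suc j) ≡ j ℕ.+ n
    reversed-index n {j} j<N = ≡.trans (≡.cong ((N ℕ.+ n) ∸_) (≡.sym (ℕₚ.+-∸-assoc 1 j<N)))
      (≡.trans (ℕₚ.+-∸-comm n (ℕₚ.m∸n≤m N j)) (≡.cong (ℕ._+ n) (ℕₚ.m∸[m∸n]≡n (ℕₚ.<⇒≤ j<N))))

  hasRecurrence⇒isLRS : ∀ {N a} → HasRecurrence N a → IsLRS a
  hasRecurrence⇒isLRS {N} {a} (shiftSpan cf a≈) = N , h , λ n N≤n →
    ≡.subst (λ t → a t ≈ sumLt (λ i → h (suc i) * a (t ∸ suc i)) N) (ℕₚ.m+[n∸m]≡n N≤n) (a[N+m]≈ (n ∸ N))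
    where
    h : ℕ → Carrier
    h zero    = 0#
    h (suc i) = cf (N ∸ suc i)
    a[N+m]≈ : ∀ m → a (N ℕ.+ m) ≈ sumLt (λ i → cf (N ∸ suc i) * a ((N ℕ.+ m) ∸ suc i)) N
    a[N+m]≈ m = trans (a≈ m) (trans (sumLt-reverse _ N)
      (sumLt-cong< N λ i i<N → *-congˡ (reflexive (≡.cong a (≡.sym (ℕₚ.+-∸-comm m i<N))))))

  module _ {q : Carrier} {g : Seq} (g-geo : Geometric q g) where

    -- E a ⋆ g = (E - q) (a ⋆ g), hence Eᵏ a ⋆ g = (E - q)ᵏ (a ⋆ g).
    E^⋆-decomposition : ∀ a k →
      Σ Seq λ r → InShiftSpan k (a ⋆ g) r × ((E^ k a ⋆ g) ≈ₛ (E^ k (a ⋆ g) +ₛ r))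
    E^⋆-decomposition a zero = (λ _ → 0#) , zero∈span 0 (λ _ → refl) , λ n → sym (+-identityʳ _)
    E^⋆-decomposition a (suc k) with E^⋆-decomposition a k
    ... | r , r∈span , E^ka⋆g≈ = r′ , r′∈span , E^[1+k]a⋆g≈
      where
      r′ : Seq
      r′ = E r +ₛ ((- q) ·ₛ (E^ k (a ⋆ g) +ₛ r))
      r′∈span : InShiftSpan (suc k) (a ⋆ g) r′
      r′∈span = span-+ (span-E r∈span) (span-· (- q) (span-+ (E^∈span k (a ⋆ g)) (span-suc r∈span)))
      E^[1+k]a⋆g≈ : (E^ (suc k) a ⋆ g) ≈ₛ (E^ (suc k) (a ⋆ g) +ₛ r′)
      E^[1+k]a⋆g≈ n = begin
        (E^ (suc k) a ⋆ g) n
          ≈⟨ ⋆-congˡ g (λ t → reflexive (≡.cong a (≡.sym (ℕₚ.+-suc k t)))) n ⟩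
        (E (E^ k a) ⋆ g) n
          ≈⟨ ⋆-geometric-E g-geo (E^ k a) n ⟩
        (E^ k a ⋆ g) (suc n) + - q * (E^ k a ⋆ g) n
          ≈⟨ +-cong (E^ka⋆g≈ (suc n)) (*-congˡ (E^ka⋆g≈ n)) ⟩
        ((a ⋆ g) (k ℕ.+ suc n) + r (suc n)) + - q * ((a ⋆ g) (k ℕ.+ n) + r n)
          ≈⟨ +-congʳ (+-congʳ (reflexive (≡.cong (a ⋆ g) (ℕₚ.+-suc k n)))) ⟩
        ((a ⋆ g) (suc k ℕ.+ n) + r (suc n)) + - q * ((a ⋆ g) (k ℕ.+ n) + r n)
          ≈⟨ +-assoc _ _ _ ⟩
        (a ⋆ g) (suc k ℕ.+ n) + r′ n ∎

    E^⋆∈span : ∀ a {j N} → j < N → InShiftSpan N (a ⋆ g) (E^ j a ⋆ g)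
    E^⋆∈span a {j} j<N with E^⋆-decomposition a j
    ... | r , r∈span , E^ja⋆g≈ = span-resp (λ n → sym (E^ja⋆g≈ n))
      (span-≤′ (ℕₚ.≤⇒≤′ j<N) (span-+ (E^∈span j (a ⋆ g)) (span-suc r∈span)))

    ⋆-preserves-recurrence : ∀ {N a} → HasRecurrence N a → HasRecurrence N (a ⋆ g)
    ⋆-preserves-recurrence {N} {a} (shiftSpan cf E^Na≈) with E^⋆-decomposition a N
    ... | r , r∈span , E^Na⋆g≈ =
      span-resp E^N[a⋆g]≈ (span-+ E^Na⋆g∈span (span-· (- 1#) r∈span))
      where
      E^Na⋆g∈span : InShiftSpan N (a ⋆ g) (E^ N a ⋆ g)
      E^Na⋆g∈span = span-resp
        (λ n → sym (trans (⋆-congˡ g E^Na≈ n) (⋆-sumLtˡ N (λ j → E^ j a) cf g n)))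
        (span-sumLt N (λ j → E^ j a ⋆ g) cf (λ j → E^⋆∈span a))
      E^N[a⋆g]≈ : ((E^ N a ⋆ g) +ₛ ((- 1#) ·ₛ r)) ≈ₛ E^ N (a ⋆ g)
      E^N[a⋆g]≈ n = trans (+-congˡ (-1*x≈-x (r n))) (sym (x≈z//y _ _ _ (sym (E^Na⋆g≈ n))))

    ⋆-preserves-LRS : ∀ {a} → IsLRS a → IsLRS (a ⋆ g)
    ⋆-preserves-LRS a-lrs with isLRS⇒hasRecurrence a-lrs
    ... | N , a-rec = hasRecurrence⇒isLRS (⋆-preserves-recurrence a-rec)

theorem13 : ∀ {c ℓ} (R : CommutativeRing c ℓ) → let open Seqs R in
    (∀ a b → a ≈ₛ b → ψ a ≈ₛ ψ b)
    × (∀ a → IsLRS a → IsLRS (ψ a))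
    × (∀ a b → IsLRS a → IsLRS b → ψ (a +ₛ b) ≈ₛ (ψ a +ₛ ψ b))
    × (∀ (r : CommutativeRing.Carrier R) a → IsLRS a → ψ (r ·ₛ a) ≈ₛ (r ·ₛ ψ a))
    × (∀ a b → IsLRS a → IsLRS b → ψ (a ⊙ b) ≈ₛ (ψ a ⊠ ψ b))
    × (ψ 𝟙⊙ ≈ₛ 𝟙⊠)
    × (∀ a b → IsLRS a → IsLRS b → ψ a ≈ₛ ψ b → a ≈ₛ b)
    × (∀ b → IsLRS b → Σ (Seq) (λ a → IsLRS a × (ψ a ≈ₛ b)))
theorem13 R =
    (λ a b → ⋆-congˡ 𝐞)
  , (λ a → ⋆-preserves-LRS 𝐞-geometric)
  , (λ a b _ _ → ⋆-+ˡ a b 𝐞)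
  , (λ r a _ → ⋆-·ˡ r a 𝐞)
  , (λ a b _ _ → ψ-⊙ a b)
  , ψ-𝟙⊙
  , (λ a b _ _ → ψ-injective)
  , (λ b b-lrs → b ⋆ 𝟙⊙ , ⋆-preserves-LRS 𝟙⊙-geometric b-lrs , ψ[b⋆𝟙⊙]≈b b)
  where
  open Seqs R
  open BinomialTransform R
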